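{- Let $X$ be a finite set with $|X|\geqslant 4$. Let $\alpha,\beta\in\mathcal{P}(X)\setminus(\mathcal{T}(X)\cup\{\emptyset\})$. Then the distance between $\alpha$ and $\beta$ in the commuting graph $\mathcal{G}(\mathcal{P}(X))$ is at most $4$.
   Context: $\mathcal{P}(X)$ is the partial transformation semigroup on $X$: all functions whose domain and image are subsets of $X$ (including the empty map $\emptyset$), with composition of functions as multiplication (maps act on the right, $x(\alpha\beta)=(x\alpha)\beta$). $\mathcal{T}(X)\subseteq\mathcal{P}(X)$ is the set of full transformations (maps with domain $X$). The center of $\mathcal{P}(X)$ is $\{\emptyset,\mathrm{id}_X\}$. For a finite non-commutative semigroup $S$, the commuting graph $\mathcal{G}(S)$ is the simple graph with vertex set $S\setminus Z(S)$ ($Z(S)$ the center), two distinct vertices $x,y$ being adjacent iff $xy=yx$. The distance between two vertices is the length (number of edges) of a shortest path between them ($\infty$ if none). -}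

module Defs where

open import Data.Nat using (ℕ; zero; suc)
open import Data.Fin using (Fin)
open import Data.Maybe using (Maybe; just; nothing; _>>=_)
open import Data.Vec using (Vec; lookup; tabulate; replicate)
open import Data.Vec.Relation.Unary.All using (All)
open import Data.Product using (Σ; ∃; _×_)
open import Relation.Binary.PropositionalEquality using (_≡_; _≢_)
open import Relation.Nullary using (¬_)

-- X = Fin n.  A partial transformation of X is represented by its graph
-- as a vector: entry i is (just j) if i ∈ dom α and iα = j, nothing otherwise.
-- This representation is canonical, so _≡_ is equality of partial maps.
PT : ℕ → Set
PT n = Vec (Maybe (Fin n)) n

app : ∀ {n} → PT n → Fin n → Maybe (Fin n)
app α x = lookup α x

-- composition, maps acting on the right: x(αβ) = (xα)β
_·_ : ∀ {n} → PT n → PT n → PT n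
α · β = tabulate (λ x → app α x >>= app β)

emptyMap : ∀ {n} → PT n
emptyMap {n} = replicate n nothing

data IsJust {A : Set} : Maybe A → Set where
  isJust : ∀ (a : A) → IsJust (just a)

Full : ∀ {n} → PT n → Set
Full α = All IsJust α

Central : ∀ {n} → PT n → Set
Central {n} γ = (δ : PT n) → γ · δ ≡ δ · γ

Vertex : ∀ {n} → PT n → Set
Vertex γ = ¬ Central γ

Adjacent : ∀ {n} → PT n → PT n → Set
Adjacent γ δ = Vertex γ × Vertex δ × γ ≢ δ × γ · δ ≡ δ · γ

data Walk {n : ℕ} : PT n → PT n → ℕ → Set where
  here  : ∀ {γ} → Vertex γ → Walk γ γ zero
  step  : ∀ {γ δ ε k} → Adjacent γ δ → Walk δ ε k → Walk γ ε (suc k)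

open import Data.Nat using (_≤_)
DistLe : ∀ {n} → PT n → PT n → ℕ → Set
DistLe γ δ k = ∃ λ m → m ≤ k × Walk γ δ m

-- Pick b₁ ∉ dom α, a₁ ∉ im α (it exists since α is not a bijection), and likewise
-- b₂, a₂ for β.  The one-point map [a₁ ↦ b₁] commutes with α since both products
-- are empty; by the same token [a ↦ b] and [c ↦ d] commute whenever c ≠ b and d ≠ a.
-- Choosing c ∉ {b₁, b₂} and d ∉ {a₁, a₂} gives the walk
-- α – [a₁ ↦ b₁] – [c ↦ d] – [a₂ ↦ b₂] – β.
module Submission where

open import Defs
open import Data.Nat using (ℕ; _≤_)
open import Relation.Binary.PropositionalEquality using (_≢_)
open import Relation.Nullary using (¬_)

open import Data.Nat using (suc; _<_; s≤s; z≤n)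
open import Data.Nat.Properties using (<⇒≱; ≤-trans; n≤1+n; n<1+n)
open import Data.Fin using (Fin; zero; suc; punchIn; punchOut; _≟_)
open import Data.Fin.Properties using (any?; ¬∀⟶∃¬; injective⇒≤; punchIn-punchOut)
open import Data.Maybe using (Maybe; just; nothing; _>>=_; fromMaybe)
import Data.Maybe.Properties as Maybe
open import Data.Vec using (Vec; []; _∷_; lookup; tabulate; replicate)
import Data.Vec.Properties as Vec
open import Data.Vec.Relation.Unary.All using (All; []; _∷_)
open import Data.Bool using (if_then_else_)
open import Data.Product using (∃; ∃₂; _×_; _,_; proj₁; proj₂)
open import Function using (_$_; _∘_)
open import Relation.Binary.PropositionalEquality using (_≡_; refl; sym; trans; cong; module ≡-Reasoning)
open import Relation.Nullary using (yes; no; does; contradiction)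
open import Relation.Nullary.Decidable using (dec-true; dec-false)

private
  variable
    A : Set
    k m n : ℕ
    a b c d x : Fin n
    α γ δ ε : PT n

nothing≢just : {y : A} → nothing ≢ just y
nothing≢just ()

surjective⇒≤ : (f : Fin m → Fin n) → (∀ w → ∃ λ i → f i ≡ w) → n ≤ m
surjective⇒≤ f hit = injective⇒≤ {f = λ w → proj₁ (hit w)} section-injective
  where
  section-injective : ∀ {v w} → proj₁ (hit v) ≡ proj₁ (hit w) → v ≡ w
  section-injective {v} {w} eq = trans (sym (proj₂ (hit v))) (trans (cong f eq) (proj₂ (hit w)))

missing-value : (f : Fin m → Fin n) → m < n → ∃ λ w → ∀ i → f i ≢ w
missing-value {n = n} f m<n
  with w , unhit ← ¬∀⟶∃¬ n (λ w → ∃ λ i → f i ≡ w) (λ w → any? λ i → f i ≟ w) (<⇒≱ m<n ∘ surjective⇒≤ f)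
  = w , λ i fi≡w → unhit (i , fi≡w)

∃-avoiding-two : 2 < n → (x y : Fin n) → ∃ λ w → w ≢ x × w ≢ y
∃-avoiding-two 2<n x y with w , missed ← missing-value (lookup (x ∷ y ∷ [])) 2<n
  = w , (λ w≡x → missed zero (sym w≡x)) , (λ w≡y → missed (suc zero) (sym w≡y))

¬All-IsJust⇒∃nothing : (v : Vec (Maybe A) m) → ¬ All IsJust v → ∃ λ i → lookup v i ≡ nothing
¬All-IsJust⇒∃nothing []            ¬all = contradiction [] ¬all
¬All-IsJust⇒∃nothing (nothing ∷ v) ¬all = zero , refl
¬All-IsJust⇒∃nothing (just y ∷ v)  ¬all
  with i , vi≡nothing ← ¬All-IsJust⇒∃nothing v (λ all → ¬all (isJust y ∷ all))
  = suc i , vi≡nothing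

≢replicate-nothing⇒∃just : (v : Vec (Maybe A) m) → v ≢ replicate m nothing → ∃₂ λ i y → lookup v i ≡ just y
≢replicate-nothing⇒∃just []            v≢nothings = contradiction refl v≢nothings
≢replicate-nothing⇒∃just (just y ∷ v)  v≢nothings = zero , y , refl
≢replicate-nothing⇒∃just (nothing ∷ v) v≢nothings
  with i , y , vi≡y ← ≢replicate-nothing⇒∃just v (λ v≡nothings → v≢nothings (cong (nothing ∷_) v≡nothings))
  = suc i , y , vi≡y

_∉Dom_ : Fin n → PT n → Set
x ∉Dom α = app α x ≡ nothing

_∉Im_ : Fin n → PT n → Set
a ∉Im α = ∀ x → app α x ≢ just a

∉Dom⇒∃∉Im : (α : PT n) → x ∉Dom α → ∃ λ a → a ∉Im α
∉Dom⇒∃∉Im {suc m} {x} α x∉α =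
  let a , missed = missing-value values (n<1+n m) in a , missed⇒∉Im a missed
  where
  -- x is a junk default where α is undefined; every value of α is attained here
  values : Fin m → Fin (suc m)
  values i = fromMaybe x (app α (punchIn x i))

  missed⇒∉Im : ∀ a → (∀ i → values i ≢ a) → a ∉Im α
  missed⇒∉Im a missed y αy≡a with x ≟ y
  ... | yes refl = nothing≢just (trans (sym x∉α) αy≡a)
  ... | no x≢y = missed (punchOut x≢y) $ begin
    fromMaybe x (app α (punchIn x (punchOut x≢y))) ≡⟨ cong (λ z → fromMaybe x (app α z)) (punchIn-punchOut x≢y) ⟩
    fromMaybe x (app α y)                          ≡⟨ cong (fromMaybe x) αy≡a ⟩
    a                                              ∎
    where open ≡-Reasoning

·-app : (α β : PT n) (x : Fin n) → app (α · β) x ≡ (app α x >>= app β)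
·-app α β x = Vec.lookup∘tabulate _ x

_↦_ : Fin n → Fin n → PT n
a ↦ b = tabulate λ x → if does (x ≟ a) then just b else nothing

↦-app : (a b x : Fin n) → app (a ↦ b) x ≡ (if does (x ≟ a) then just b else nothing)
↦-app a b = Vec.lookup∘tabulate _

↦-app-self : (a b : Fin n) → app (a ↦ b) a ≡ just b
↦-app-self a b = trans (↦-app a b a) (cong (if_then just b else nothing) (dec-true (a ≟ a) refl))

∉Dom-↦ : x ≢ a → x ∉Dom (a ↦ b)
∉Dom-↦ {x = x} {a} {b} x≢a = trans (↦-app a b x) (cong (if_then just b else nothing) (dec-false (x ≟ a) x≢a))

∉Im-↦ : c ≢ b → c ∉Im (a ↦ b)
∉Im-↦ {c = c} {b} {a} c≢b x ↦x≡c with x ≟ a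
... | yes refl = c≢b (Maybe.just-injective (trans (sym ↦x≡c) (↦-app-self a b)))
... | no x≢a = nothing≢just (trans (sym (∉Dom-↦ x≢a)) ↦x≡c)

↦-comm : (α : PT n) → a ∉Im α → b ∉Dom α → α · (a ↦ b) ≡ (a ↦ b) · α
↦-comm {a = a} {b} α a∉α b∉α = Vec.tabulate-cong λ x → trans (α-then-↦ x) (sym (↦-then-α x))
  where
  α-then-↦ : ∀ x → (app α x >>= app (a ↦ b)) ≡ nothing
  α-then-↦ x with app α x in αx≡y
  ... | nothing = refl
  ... | just y = ∉Dom-↦ λ { refl → a∉α x αx≡y }

  ↦-then-α : ∀ x → (app (a ↦ b) x >>= app α) ≡ nothing
  ↦-then-α x with x ≟ a
  ... | yes refl = trans (cong (_>>= app α) (↦-app-self a b)) b∉α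
  ... | no x≢a = cong (_>>= app α) (∉Dom-↦ x≢a)

↦-comm-↦ : c ≢ b → d ≢ a → (a ↦ b) · (c ↦ d) ≡ (c ↦ d) · (a ↦ b)
↦-comm-↦ {b = b} {a = a} c≢b d≢a = ↦-comm (a ↦ b) (∉Im-↦ c≢b) (∉Dom-↦ d≢a)

∉Dom-∈Dom⇒Vertex : (α : PT n) → b ∉Dom α → app α c ≡ just d → Vertex α
∉Dom-∈Dom⇒Vertex {b = b} {c} {d} α b∉α αc≡d central = nothing≢just $ begin
  nothing                        ≡⟨ sym (cong (_>>= app (b ↦ c)) b∉α) ⟩
  (app α b >>= app (b ↦ c))      ≡⟨ sym (·-app α (b ↦ c) b) ⟩
  app (α · (b ↦ c)) b            ≡⟨ cong (λ γ → app γ b) (central (b ↦ c)) ⟩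
  app ((b ↦ c) · α) b            ≡⟨ ·-app (b ↦ c) α b ⟩
  (app (b ↦ c) b >>= app α)      ≡⟨ cong (_>>= app α) (↦-app-self b c) ⟩
  app α c                        ≡⟨ αc≡d ⟩
  just d                         ∎
  where open ≡-Reasoning

¬Full⇒≢empty⇒Vertex : (α : PT n) → ¬ Full α → α ≢ emptyMap → Vertex α
¬Full⇒≢empty⇒Vertex α α-partial α-nonempty
  with b , b∉α ← ¬All-IsJust⇒∃nothing α α-partial
     | c , d , αc≡d ← ≢replicate-nothing⇒∃just α α-nonempty
  = ∉Dom-∈Dom⇒Vertex α b∉α αc≡d

↦-Vertex : 1 < n → (a b : Fin n) → Vertex (a ↦ b)
↦-Vertex 1<n a b with w , missed ← missing-value (λ (_ : Fin 1) → a) 1<n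
  = ∉Dom-∈Dom⇒Vertex (a ↦ b) (∉Dom-↦ λ w≡a → missed zero (sym w≡a)) (↦-app-self a b)

Walk⇒Vertex : Walk γ δ k → Vertex γ
Walk⇒Vertex (here vγ) = vγ
Walk⇒Vertex (step (vγ , _) _) = vγ

DistLe-refl : Vertex γ → DistLe γ γ 0
DistLe-refl vγ = 0 , z≤n , here vγ

DistLe-cons : Vertex γ → (δ : PT n) → γ · δ ≡ δ · γ → DistLe δ ε k → DistLe γ ε (suc k)
DistLe-cons {γ = γ} vγ δ γδ≡δγ (m , m≤k , walk) with Vec.≡-dec (Maybe.≡-dec _≟_) γ δ
... | yes refl = m , ≤-trans m≤k (n≤1+n _) , walk
... | no γ≢δ = suc m , s≤s m≤k , step (vγ , Walk⇒Vertex walk , γ≢δ , γδ≡δγ) walk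

lemma3p2 : (n : ℕ) → 4 ≤ n → (α β : PT n) →
    ¬ Full α → α ≢ emptyMap → ¬ Full β → β ≢ emptyMap →
    DistLe α β 4
lemma3p2 n 4≤n α β α-partial α-nonempty β-partial β-nonempty =
  let b₁ , b₁∉α = ¬All-IsJust⇒∃nothing α α-partial
      b₂ , b₂∉β = ¬All-IsJust⇒∃nothing β β-partial
      a₁ , a₁∉α = ∉Dom⇒∃∉Im α b₁∉α
      a₂ , a₂∉β = ∉Dom⇒∃∉Im β b₂∉β
      c , c≢b₁ , c≢b₂ = ∃-avoiding-two 2<n b₁ b₂
      d , d≢a₁ , d≢a₂ = ∃-avoiding-two 2<n a₁ a₂
  in DistLe-cons (¬Full⇒≢empty⇒Vertex α α-partial α-nonempty) (a₁ ↦ b₁) (↦-comm α a₁∉α b₁∉α) $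
     DistLe-cons (↦-Vertex 1<n a₁ b₁) (c ↦ d) (↦-comm-↦ c≢b₁ d≢a₁) $
     DistLe-cons (↦-Vertex 1<n c d) (a₂ ↦ b₂) (↦-comm-↦ (d≢a₂ ∘ sym) (c≢b₂ ∘ sym)) $
     DistLe-cons (↦-Vertex 1<n a₂ b₂) β (sym (↦-comm β a₂∉β b₂∉β)) $
     DistLe-refl (¬Full⇒≢empty⇒Vertex β β-partial β-nonempty)
  where
  2<n : 2 < n
  2<n = ≤-trans (s≤s (s≤s (s≤s z≤n))) 4≤n
  1<n : 1 < n
  1<n = ≤-trans (s≤s (s≤s z≤n)) 4≤n
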